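{- Let $m\ge 2$, let $\mathfrak{s}$ be a map (with one face) all of whose vertices have degree $3$, each edge carrying a fixed orientation, and let $\tau$ be a typing of $\mathfrak{s}$. Call an edge $e$ special if $\tau(e)\ne 0$. For a vertex $v$ and a special edge $e$ incident to $v$ (through a given half-edge), set $\tilde\tau=\tau(e)$ if that half-edge is incoming at $v$ and $\tilde\tau=m-\tau(e)$ if it is outgoing. Let $v_3^{(1)}$ be the number of vertices whose three incident half-edges all belong to special edges and satisfy $\tilde\tau_1+\tilde\tau_2+\tilde\tau_3=m$, and $v_3^{(2)}$ the number of vertices whose three incident half-edges all belong to special edges and satisfy $\tilde\tau_1+\tilde\tau_2+\tilde\tau_3=2m$. Then $v_3^{(1)}=v_3^{(2)}$.
   Context: A typing of $\mathfrak{s}$ is a map $\tau$ from the set of edges to $\{0,1,\dots,m-1\}$ such that at every vertex $v$, $\sum_{e\text{ outgoing at }v}\tau(e)-\sum_{e\text{ ingoing at }v}\tau(e)\equiv0\pmod m$ (a loop contributes once as outgoing and once as ingoing). -}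

module Defs where

open import Data.Nat using (ℕ; zero; suc; _≤ᵇ_; _≡ᵇ_; _∸_; _≤_)
import Data.Nat as ℕ
open import Data.Bool using (Bool; true; false; not; _∧_; if_then_else_)
open import Data.Fin using (Fin; toℕ)
open import Data.List using (List; length; filterᵇ; allFin)
open import Data.Integer using (ℤ; +_; -_; _+_)
open import Data.Integer.Divisibility using (_∣_)
open import Data.Product using (∃)
open import Relation.Binary.PropositionalEquality using (_≡_; _≢_)

iter : {A : Set} → (A → A) → ℕ → A → A
iter f zero    x = x
iter f (suc k) x = f (iter f k x)

-- A combinatorial map on the half-edge set Fin H:
--   σ : rotation around vertices (vertices = σ-cycles),
--   α : fixed-point-free involution (edges = α-orbits),
--   faces = cycles of φ = σ ∘ α.
-- All vertices have degree 3: σ³ = id and σ has no fixed point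
-- (so every σ-cycle has length exactly 3).
-- Orientation: out h = true iff half-edge h is outgoing at its vertex
-- (the tail of its edge); the two halves of an edge have opposite values.
record OrientedCubicUnicellularMap : Set where
  field
    H       : ℕ
    σ       : Fin H → Fin H
    α       : Fin H → Fin H
    σ³≡id   : ∀ h → σ (σ (σ h)) ≡ h
    σ-nofix : ∀ h → σ h ≢ h
    α-invol : ∀ h → α (α h) ≡ h
    α-nofix : ∀ h → α h ≢ h
    oneFace : ∀ h h′ → ∃ λ k → iter (λ x → σ (α x)) k h ≡ h′
    out     : Fin H → Bool
    out-α   : ∀ h → out (α h) ≡ not (out h)

module _ (𝔰 : OrientedCubicUnicellularMap) (m : ℕ) where
  open OrientedCubicUnicellularMap 𝔰

  signed : (Fin H → Fin m) → Fin H → ℤ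
  signed τ h = if out h then + toℕ (τ h) else - (+ toℕ (τ h))

  -- A typing: a map from edges to {0,…,m-1} (a function on half-edges
  -- constant on α-orbits) satisfying the vertex condition mod m.
  record IsTyping (τ : Fin H → Fin m) : Set where
    field
      edge-const : ∀ h → τ (α h) ≡ τ h
      vertex-cond : ∀ h → + m ∣ (signed τ h + signed τ (σ h) + signed τ (σ (σ h)))

  module _ (τ : Fin H → Fin m) where
    special : Fin H → Bool
    special h = not (toℕ (τ h) ≡ᵇ 0)

    τ̃ : Fin H → ℕ
    τ̃ h = if out h then m ∸ toℕ (τ h) else toℕ (τ h)

    -- h is the chosen representative of its vertex (minimal in its σ-cycle)
    isRep : Fin H → Bool
    isRep h = (toℕ h ≤ᵇ toℕ (σ h)) ∧ (toℕ h ≤ᵇ toℕ (σ (σ h)))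

    vertexWith : ℕ → Fin H → Bool
    vertexWith k h = isRep h ∧ special h ∧ special (σ h) ∧ special (σ (σ h))
                     ∧ ((τ̃ h ℕ.+ τ̃ (σ h) ℕ.+ τ̃ (σ (σ h))) ≡ᵇ k)

    v₃⁽¹⁾ : ℕ
    v₃⁽¹⁾ = length (filterᵇ (vertexWith m) (allFin H))

    v₃⁽²⁾ : ℕ
    v₃⁽²⁾ = length (filterᵇ (vertexWith (2 ℕ.* m)) (allFin H))

-- Give each half-edge h the weight w h = τ̃ h if its edge is special and 0 otherwise.
-- The two halves of a special edge carry τ(e) and m − τ(e), so 2 Σ w = m · #(special half-edges).
-- At a vertex each weight is congruent mod m to minus the signed contribution of its half-edge,
-- so the vertex sum S of the weights is a multiple of m; with k special half-edges there,
-- k ≤ S ≤ k (m − 1), which rules out k = 1 and forces S = 0 for k = 0, S = m for k = 2 and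
-- S ∈ {m, 2m} for k = 3. In every case 2S + m [k = 3, S = m] = m k + m [k = 3, S = 2m];
-- summing over the vertices and comparing with the edge count gives m v₃⁽¹⁾ = m v₃⁽²⁾.

module Submission where

open import Defs
open import Data.Nat using (ℕ; _≤_)
open import Data.Fin using (Fin)
open import Relation.Binary.PropositionalEquality using (_≡_)

open import Data.Nat as ℕ using (zero; suc; _+_; _*_; _∸_; _<_; _≡ᵇ_; _≤ᵇ_; _≟_; _≤?_; NonZero; z≤n; s≤s)
open import Data.Nat.Properties
open import Data.Nat.Divisibility using (_∣_; divides; n∣m*n; ∣m∣n⇒∣m+n)
open import Data.Nat.Tactic.RingSolver using (solve-∀)
import Data.Integer.Tactic.RingSolver as ℤ-Solver
open import Data.Bool using (Bool; true; false; not; _∧_; if_then_else_)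
open import Data.Bool.Properties using (∧-zeroʳ)
open import Data.Fin using (toℕ)
open import Data.Fin.Properties using (toℕ<n; toℕ-injective)
open import Data.Fin.Permutation using (permutation)
open import Data.List using (length; filterᵇ; allFin; tabulate)
open import Data.Integer as ℤ using (+_; -_)
import Data.Integer.Properties as ℤₚ
import Algebra.Properties.CommutativeSemigroup as CommutativeSemigroup
import Data.Integer.Divisibility.Signed as ℤ∣
open import Algebra.Properties.Semiring.Sum +-*-semiring using (sum; sum-cong-≗; sum-permute; ∑-distrib-+; *-distribʳ-sum)
open import Data.Product using (_×_; _,_; ∃-syntax)
open import Data.Sum using (_⊎_; inj₁; inj₂)
open import Data.Empty using (⊥-elim)
open import Function using (_∘_)
open import Relation.Nullary.Decidable using (dec-true; dec-false)
open import Relation.Binary.Definitions using (tri<; tri≈; tri>)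
open import Relation.Binary.PropositionalEquality using (refl; sym; trans; cong; cong₂; subst; _≢_; module ≡-Reasoning)

𝟙 : Bool → ℕ
𝟙 true  = 1
𝟙 false = 0

𝟙-∧ : ∀ a b → 𝟙 (a ∧ b) ≡ 𝟙 a * 𝟙 b
𝟙-∧ true  b = sym (+-identityʳ (𝟙 b))
𝟙-∧ false b = refl

𝟙≤1 : ∀ b → 𝟙 b ≤ 1
𝟙≤1 true  = ≤-refl
𝟙≤1 false = z≤n

≡ᵇ-true : ∀ {a b} → a ≡ b → (a ≡ᵇ b) ≡ true
≡ᵇ-true {a} {b} a≡b = dec-true (a ≟ b) a≡b

≡ᵇ-false : ∀ {a b} → a ≢ b → (a ≡ᵇ b) ≡ false
≡ᵇ-false {a} {b} a≢b = dec-false (a ≟ b) a≢b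

length-filterᵇ-allFin : ∀ {n} (p : Fin n → Bool) → length (filterᵇ p (allFin n)) ≡ sum (𝟙 ∘ p)
length-filterᵇ-allFin p = length-filterᵇ-tabulate p (λ i → i)
  where
  length-filterᵇ-tabulate : ∀ {j k} (q : Fin j → Bool) (f : Fin k → Fin j) →
                            length (filterᵇ q (tabulate f)) ≡ sum (𝟙 ∘ q ∘ f)
  length-filterᵇ-tabulate {k = zero}  q f = refl
  length-filterᵇ-tabulate {k = suc k} q f with q (f Data.Fin.zero)
  ... | true  = cong suc (length-filterᵇ-tabulate q (f ∘ Data.Fin.suc))
  ... | false = length-filterᵇ-tabulate q (f ∘ Data.Fin.suc)

sum-+₃ : ∀ {n} (f g h : Fin n → ℕ) → sum (λ i → f i + g i + h i) ≡ sum f + sum g + sum h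
sum-+₃ f g h = trans (∑-distrib-+ (λ i → f i + g i) h) (cong (_+ sum h) (∑-distrib-+ f g))

module _ {n} (π π⁻¹ : Fin n → Fin n) (π∘π⁻¹ : ∀ i → π (π⁻¹ i) ≡ i) (π⁻¹∘π : ∀ i → π⁻¹ (π i) ≡ i) where

  sum-reindex : (f : Fin n → ℕ) → sum (f ∘ π⁻¹) ≡ sum f
  sum-reindex f = sym (sum-permute f (permutation π⁻¹ π π⁻¹∘π π∘π⁻¹))

  sum-shift : (g f : Fin n → ℕ) → sum (λ i → g (π i) * f i) ≡ sum (λ i → g i * f (π⁻¹ i))
  sum-shift g f = begin
    sum (λ i → g (π i) * f i)                 ≡⟨ sum-reindex (λ i → g (π i) * f i) ⟨
    sum (λ i → g (π (π⁻¹ i)) * f (π⁻¹ i))     ≡⟨ sum-cong-≗ (λ i → cong (λ j → g j * f (π⁻¹ i)) (π∘π⁻¹ i)) ⟩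
    sum (λ i → g i * f (π⁻¹ i))               ∎
    where open ≡-Reasoning

≤ᵇ-true : ∀ {a b} → a < b → (a ≤ᵇ b) ≡ true
≤ᵇ-true {a} {b} a<b = dec-true (a ≤? b) (<⇒≤ a<b)

≤ᵇ-false : ∀ {a b} → b < a → (a ≤ᵇ b) ≡ false
≤ᵇ-false {a} {b} b<a = dec-false (a ≤? b) (<⇒≱ b<a)

least-of-three : ∀ {a b c} → a ≢ b → b ≢ c → c ≢ a →
                 (a < b × a < c) ⊎ (b < c × b < a) ⊎ (c < a × c < b)
least-of-three {a} {b} {c} a≢b b≢c c≢a with <-cmp a b | <-cmp b c | <-cmp c a
... | tri≈ _ a≡b _ | _            | _            = ⊥-elim (a≢b a≡b)
... | _            | tri≈ _ b≡c _ | _            = ⊥-elim (b≢c b≡c)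
... | _            | _            | tri≈ _ c≡a _ = ⊥-elim (c≢a c≡a)
... | tri< a<b _ _ | tri< b<c _ _ | tri< c<a _ _ = ⊥-elim (<-asym (<-trans a<b b<c) c<a)
... | tri> _ _ b<a | tri> _ _ c<b | tri> _ _ a<c = ⊥-elim (<-asym (<-trans b<a a<c) c<b)
... | tri< a<b _ _ | _            | tri> _ _ a<c = inj₁ (a<b , a<c)
... | tri> _ _ b<a | tri< b<c _ _ | _            = inj₂ (inj₁ (b<c , b<a))
... | _            | tri> _ _ c<b | tri< c<a _ _ = inj₂ (inj₂ (c<a , c<b))

least-test : ∀ {x y z} → x < y → x < z → 𝟙 ((x ≤ᵇ y) ∧ (x ≤ᵇ z)) ≡ 1
least-test x<y x<z = cong 𝟙 (cong₂ _∧_ (≤ᵇ-true x<y) (≤ᵇ-true x<z))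

non-least-testˡ : ∀ {x y} b → y < x → 𝟙 ((x ≤ᵇ y) ∧ b) ≡ 0
non-least-testˡ b y<x = cong (λ c → 𝟙 (c ∧ b)) (≤ᵇ-false y<x)

non-least-testʳ : ∀ {x y} b → y < x → 𝟙 (b ∧ (x ≤ᵇ y)) ≡ 0
non-least-testʳ b y<x = cong 𝟙 (trans (cong (b ∧_) (≤ᵇ-false y<x)) (∧-zeroʳ b))

exactly-one-least : ∀ {a b c} → a ≢ b → b ≢ c → c ≢ a →
  𝟙 ((a ≤ᵇ b) ∧ (a ≤ᵇ c)) + 𝟙 ((b ≤ᵇ c) ∧ (b ≤ᵇ a)) + 𝟙 ((c ≤ᵇ a) ∧ (c ≤ᵇ b)) ≡ 1
exactly-one-least {a} {b} {c} a≢b b≢c c≢a with least-of-three a≢b b≢c c≢a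
... | inj₁ (a<b , a<c) =
  cong₂ _+_ (cong₂ _+_ (least-test a<b a<c) (non-least-testʳ (b ≤ᵇ c) a<b)) (non-least-testˡ (c ≤ᵇ b) a<c)
... | inj₂ (inj₁ (b<c , b<a)) =
  cong₂ _+_ (cong₂ _+_ (non-least-testˡ (a ≤ᵇ c) b<a) (least-test b<c b<a)) (non-least-testʳ (c ≤ᵇ a) b<c)
... | inj₂ (inj₂ (c<a , c<b)) =
  cong₂ _+_ (cong₂ _+_ (non-least-testʳ (a ≤ᵇ b) c<a) (non-least-testˡ (b ≤ᵇ a) c<b)) (least-test c<a c<b)

module ThreeCycles {n} (σ : Fin n → Fin n) (σ³≡id : ∀ i → σ (σ (σ i)) ≡ i) (σ-nofix : ∀ i → σ i ≢ i) where

  isLeast : Fin n → Bool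
  isLeast i = (toℕ i ≤ᵇ toℕ (σ i)) ∧ (toℕ i ≤ᵇ toℕ (σ (σ i)))

  cycleSum : (Fin n → ℕ) → Fin n → ℕ
  cycleSum f i = f i + f (σ i) + f (σ (σ i))

  sumᶜ : (Fin n → ℕ) → ℕ
  sumᶜ f = sum (λ i → 𝟙 (isLeast i) * f i)

  one-least-per-cycle : ∀ i → cycleSum (𝟙 ∘ isLeast) i ≡ 1
  one-least-per-cycle i =
    trans (cong (λ j → 𝟙 (isLeast i) + 𝟙 ((b ≤ᵇ c) ∧ (b ≤ᵇ toℕ j)) + 𝟙 ((c ≤ᵇ toℕ j) ∧ (c ≤ᵇ toℕ (σ j)))) (σ³≡id i))
          (exactly-one-least a≢b b≢c c≢a)
    where
    a = toℕ i
    b = toℕ (σ i)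
    c = toℕ (σ (σ i))
    a≢b : a ≢ b
    a≢b a≡b = σ-nofix i (sym (toℕ-injective a≡b))
    b≢c : b ≢ c
    b≢c b≡c = σ-nofix (σ i) (sym (toℕ-injective b≡c))
    c≢a : c ≢ a
    c≢a c≡a = σ-nofix i (trans (cong σ (sym (toℕ-injective c≡a))) (σ³≡id i))

  sum-by-cycles : (f : Fin n → ℕ) → sum f ≡ sumᶜ (cycleSum f)
  sum-by-cycles f = begin
    sum f
      ≡⟨ sum-cong-≗ (λ i → trans (sym (*-identityˡ (f i))) (cong (_* f i) (sym (one-least-per-cycle i)))) ⟩
    sum (λ i → (r i + r (σ i) + r (σ (σ i))) * f i)
      ≡⟨ sum-cong-≗ (λ i → *-distribʳ-+₃ (r i) (r (σ i)) (r (σ (σ i))) (f i)) ⟩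
    sum (λ i → r i * f i + r (σ i) * f i + r (σ (σ i)) * f i)
      ≡⟨ sum-+₃ (λ i → r i * f i) (λ i → r (σ i) * f i) (λ i → r (σ (σ i)) * f i) ⟩
    sum (λ i → r i * f i) + sum (λ i → r (σ i) * f i) + sum (λ i → r (σ (σ i)) * f i)
      ≡⟨ cong₂ (λ x y → sum (λ i → r i * f i) + x + y)
               (sum-shift σ (σ ∘ σ) σ³≡id σ³≡id r f)
               (sum-shift (σ ∘ σ) σ σ³≡id σ³≡id r f) ⟩
    sum (λ i → r i * f i) + sum (λ i → r i * f (σ (σ i))) + sum (λ i → r i * f (σ i))
      ≡⟨ sum-+₃ (λ i → r i * f i) (λ i → r i * f (σ (σ i))) (λ i → r i * f (σ i)) ⟨
    sum (λ i → r i * f i + r i * f (σ (σ i)) + r i * f (σ i))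
      ≡⟨ sum-cong-≗ (λ i → collect (r i) (f i) (f (σ i)) (f (σ (σ i)))) ⟩
    sumᶜ (cycleSum f) ∎
    where
    open ≡-Reasoning
    r = 𝟙 ∘ isLeast
    *-distribʳ-+₃ : ∀ x y z w → (x + y + z) * w ≡ x * w + y * w + z * w
    *-distribʳ-+₃ = solve-∀
    collect : ∀ x y z w → x * y + x * w + x * z ≡ x * (y + z + w)
    collect = solve-∀

  sumᶜ-+ : (f g : Fin n → ℕ) → sumᶜ (λ i → f i + g i) ≡ sumᶜ f + sumᶜ g
  sumᶜ-+ f g = trans (sum-cong-≗ (λ i → *-distribˡ-+ (𝟙 (isLeast i)) (f i) (g i)))
                     (∑-distrib-+ (λ i → 𝟙 (isLeast i) * f i) (λ i → 𝟙 (isLeast i) * g i))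

  sumᶜ-*ʳ : (f : Fin n → ℕ) (k : ℕ) → sumᶜ (λ i → f i * k) ≡ sumᶜ f * k
  sumᶜ-*ʳ f k = trans (sum-cong-≗ (λ i → sym (*-assoc (𝟙 (isLeast i)) (f i) k)))
                      (sym (*-distribʳ-sum k (λ i → 𝟙 (isLeast i) * f i)))

module Weights (m : ℕ) where

  -- k ≤ S ≤ k (m − 1), written without truncated subtraction.
  Admissible : ℕ → ℕ → Set
  Admissible k S = k ≤ S × S + k ≤ k * m

  admissible-+ : ∀ {k k′ S S′} → Admissible k S → Admissible k′ S′ → Admissible (k + k′) (S + S′)
  admissible-+ {k} {k′} {S} {S′} (k≤S , S+k≤km) (k′≤S′ , S′+k′≤k′m) =
    +-mono-≤ k≤S k′≤S′ ,
    ≤-trans (≤-reflexive (interchange S S′ k k′))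
            (≤-trans (+-mono-≤ S+k≤km S′+k′≤k′m) (≤-reflexive (sym (*-distribʳ-+ m k k′))))
    where open CommutativeSemigroup +-commutativeSemigroup using (interchange)

  nonzero : ℕ → Bool
  nonzero t = not (t ≡ᵇ 0)

  tilde : Bool → ℕ → ℕ
  tilde o t = if o then m ∸ t else t

  weight : Bool → ℕ → ℕ
  weight o t = if nonzero t then tilde o t else 0

  signedℤ : Bool → ℕ → ℤ.ℤ
  signedℤ o t = if o then + t else - (+ t)

  weight-admissible : ∀ o {t} → t < m → Admissible (𝟙 (nonzero t)) (weight o t)
  weight-admissible o     {zero}  _   = z≤n , z≤n
  weight-admissible true  {suc t} t<m =
    m<n⇒0<n∸m t<m ,
    ≤-trans (+-monoʳ-≤ (m ∸ suc t) (s≤s z≤n)) (≤-reflexive (trans (m∸n+n≡m (<⇒≤ t<m)) (sym (*-identityˡ m))))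
  weight-admissible false {suc t} t<m =
    s≤s z≤n , ≤-trans (≤-reflexive (+-comm (suc t) 1)) (≤-trans t<m (≤-reflexive (sym (*-identityˡ m))))

  weight-+-reversed : ∀ o {t} → t < m → weight o t + weight (not o) t ≡ 𝟙 (nonzero t) * m
  weight-+-reversed o     {zero}  _   = refl
  weight-+-reversed true  {suc t} t<m = trans (m∸n+n≡m (<⇒≤ t<m)) (sym (*-identityˡ m))
  weight-+-reversed false {suc t} t<m = trans (m+[n∸m]≡n (<⇒≤ t<m)) (sym (*-identityˡ m))

  weight-+-signed : ∀ o {t} → t < m → + weight o t ℤ.+ signedℤ o t ≡ + (𝟙 (o ∧ nonzero t) * m)
  weight-+-signed true  {zero}  _   = refl
  weight-+-signed false {zero}  _   = refl
  weight-+-signed true  {suc t} t<m = cong +_ (trans (m∸n+n≡m (<⇒≤ t<m)) (sym (*-identityˡ m)))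
  weight-+-signed false {suc t} _   = ℤₚ.+-inverseʳ (+ suc t)

  weight-nonzero : ∀ o {t} → nonzero t ≡ true → weight o t ≡ tilde o t
  weight-nonzero o {t} nz = cong (λ b → if b then tilde o t else 0) nz

module VertexArithmetic (m : ℕ) .{{_ : NonZero m}} where
  open Weights m using (Admissible)

  multiple-between : ∀ {k S} → m ∣ S → 0 < S → S < k * m → ∃[ j ] S ≡ j * m × 0 < j × j < k
  multiple-between     (divides zero    refl) ()
  multiple-between {k} (divides (suc j) refl) _ S<km = suc j , refl , s≤s z≤n , *-cancelʳ-< m (suc j) k S<km

  admissible-multiple-quotient : ∀ {k S} → Admissible (suc k) S → m ∣ S → ∃[ j ] S ≡ j * m × 0 < j × j < suc k
  admissible-multiple-quotient {k} {S} (k≤S , S+k≤km) m∣S =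
    multiple-between m∣S (<-≤-trans (s≤s z≤n) k≤S) (<-≤-trans (m<m+n S (s≤s z≤n)) S+k≤km)

  double-admissible-multiple : ∀ {k S} → k ≤ 2 → Admissible k S → m ∣ S → S + S ≡ k * m
  double-admissible-multiple {zero}  _ (_ , S+0≤0) _ = cong (λ x → x + x) (n≤0⇒n≡0 (≤-trans (m≤m+n _ 0) S+0≤0))
  double-admissible-multiple {1} _ adm m∣S with admissible-multiple-quotient adm m∣S
  ... | zero  , _ , () , _
  ... | suc _ , _ , _  , s≤s ()
  double-admissible-multiple {2} _ adm m∣S with admissible-multiple-quotient adm m∣S
  ... | zero        , _    , () , _
  ... | suc zero    , refl , _  , _ = sym (*-distribʳ-+ m 1 1)
  ... | suc (suc _) , _    , _  , s≤s (s≤s ())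
  double-admissible-multiple {suc (suc (suc _))} (s≤s (s≤s ()))

  admissible-multiple-3 : ∀ {S} → Admissible 3 S → m ∣ S → S ≡ m ⊎ S ≡ 2 * m
  admissible-multiple-3 adm m∣S with admissible-multiple-quotient adm m∣S
  ... | zero              , _    , () , _
  ... | suc zero          , refl , _  , _ = inj₁ (*-identityˡ m)
  ... | suc (suc zero)    , refl , _  , _ = inj₂ refl
  ... | suc (suc (suc _)) , _    , _  , s≤s (s≤s (s≤s ()))

  m≢2m : m ≢ 2 * m
  m≢2m m≡2m = 1≢2 (*-cancelʳ-≡ 1 2 m (trans (*-identityˡ m) m≡2m))
    where
    1≢2 : 1 ≢ 2
    1≢2 ()

  private
    sum-is-m : ∀ x → x + x + 1 * x ≡ 3 * x + 0 * x
    sum-is-m = solve-∀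
    sum-is-2m : ∀ x → 2 * x + 2 * x + 0 * x ≡ 3 * x + 1 * x
    sum-is-2m = solve-∀

  triple-balance : ∀ s₁ s₂ s₃ {S} → Admissible (𝟙 s₁ + 𝟙 s₂ + 𝟙 s₃) S → m ∣ S →
    S + S + 𝟙 (s₁ ∧ s₂ ∧ s₃ ∧ (S ≡ᵇ m)) * m ≡ (𝟙 s₁ + 𝟙 s₂ + 𝟙 s₃) * m + 𝟙 (s₁ ∧ s₂ ∧ s₃ ∧ (S ≡ᵇ 2 * m)) * m
  triple-balance true true true adm m∣S with admissible-multiple-3 adm m∣S
  ... | inj₁ refl rewrite ≡ᵇ-true {m} refl     | ≡ᵇ-false m≢2m         = sum-is-m m
  ... | inj₂ refl rewrite ≡ᵇ-true {2 * m} refl | ≡ᵇ-false (m≢2m ∘ sym) = sum-is-2m m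
  triple-balance true  true  false adm m∣S = cong (_+ 0) (double-admissible-multiple ≤-refl adm m∣S)
  triple-balance true  false s₃    adm m∣S = cong (_+ 0) (double-admissible-multiple (s≤s (𝟙≤1 s₃)) adm m∣S)
  triple-balance false s₂    s₃    adm m∣S =
    cong (_+ 0) (double-admissible-multiple (+-mono-≤ (𝟙≤1 s₂) (𝟙≤1 s₃)) adm m∣S)

guarded-sum-test-cong : ∀ s₁ s₂ s₃ {x₁ x₂ x₃ y₁ y₂ y₃} k →
  (s₁ ≡ true → x₁ ≡ y₁) → (s₂ ≡ true → x₂ ≡ y₂) → (s₃ ≡ true → x₃ ≡ y₃) →
  (s₁ ∧ s₂ ∧ s₃ ∧ (x₁ + x₂ + x₃ ≡ᵇ k)) ≡ (s₁ ∧ s₂ ∧ s₃ ∧ (y₁ + y₂ + y₃ ≡ᵇ k))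
guarded-sum-test-cong true  true  true  k x₁≡y₁ x₂≡y₂ x₃≡y₃ =
  cong (_≡ᵇ k) (cong₂ _+_ (cong₂ _+_ (x₁≡y₁ refl) (x₂≡y₂ refl)) (x₃≡y₃ refl))
guarded-sum-test-cong true  true  false k _ _ _ = refl
guarded-sum-test-cong true  false _     k _ _ _ = refl
guarded-sum-test-cong false _     _     k _ _ _ = refl

module CubicMapTyping (m : ℕ) .{{_ : NonZero m}} (𝔰 : OrientedCubicUnicellularMap)
  (τ : Fin (OrientedCubicUnicellularMap.H 𝔰) → Fin m) (typing : IsTyping 𝔰 m τ) where
  open OrientedCubicUnicellularMap 𝔰
  open IsTyping typing
  open Weights m
  open VertexArithmetic m
  open ThreeCycles σ σ³≡id σ-nofix

  sp : Fin H → Bool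
  sp = special 𝔰 m τ

  w : Fin H → ℕ
  w h = weight (out h) (toℕ (τ h))

  allSpecialWithSum : ℕ → Fin H → Bool
  allSpecialWithSum k h = sp h ∧ sp (σ h) ∧ sp (σ (σ h)) ∧ (cycleSum (τ̃ 𝔰 m τ) h ≡ᵇ k)

  edge-balance : sum w + sum w ≡ sum (𝟙 ∘ sp) * m
  edge-balance = begin
    sum w + sum w              ≡⟨ cong (λ x → sum w + x) (sum-reindex α α α-invol α-invol w) ⟨
    sum w + sum (w ∘ α)        ≡⟨ ∑-distrib-+ w (w ∘ α) ⟨
    sum (λ h → w h + w (α h))  ≡⟨ sum-cong-≗ edge ⟩
    sum (λ h → 𝟙 (sp h) * m)   ≡⟨ *-distribʳ-sum m (𝟙 ∘ sp) ⟨
    sum (𝟙 ∘ sp) * m           ∎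
    where
    open ≡-Reasoning
    edge : ∀ h → w h + w (α h) ≡ 𝟙 (sp h) * m
    edge h = trans (cong₂ (λ o i → w h + weight o (toℕ i)) (out-α h) (edge-const h))
                   (weight-+-reversed (out h) (toℕ<n (τ h)))

  vertex-divisible : ∀ h → m ∣ cycleSum w h
  vertex-divisible h =
    ℤ∣.∣⇒∣ᵤ (ℤ∣.∣m+n∣n⇒∣m {+ m} {+ cycleSum w h} {signs}
              (subst (ℤ∣._∣_ (+ m)) (sym weights+signs) (ℤ∣.∣ᵤ⇒∣ multiple))
              (ℤ∣.∣ᵤ⇒∣ (vertex-cond h)))
    where
    s = signed 𝔰 m τ
    signs = s h ℤ.+ s (σ h) ℤ.+ s (σ (σ h))
    k : Fin H → ℕ
    k i = 𝟙 (out i ∧ sp i)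
    regroup : ∀ a b c x y z → (a ℤ.+ b ℤ.+ c) ℤ.+ (x ℤ.+ y ℤ.+ z) ≡ (a ℤ.+ x) ℤ.+ (b ℤ.+ y) ℤ.+ (c ℤ.+ z)
    regroup = ℤ-Solver.solve-∀
    weight+sign : ∀ i → + w i ℤ.+ s i ≡ + (k i * m)
    weight+sign i = weight-+-signed (out i) (toℕ<n (τ i))
    weights+signs : + cycleSum w h ℤ.+ signs ≡ + (k h * m + k (σ h) * m + k (σ (σ h)) * m)
    weights+signs = trans (regroup (+ w h) (+ w (σ h)) (+ w (σ (σ h))) (s h) (s (σ h)) (s (σ (σ h))))
                          (cong₂ ℤ._+_ (cong₂ ℤ._+_ (weight+sign h) (weight+sign (σ h))) (weight+sign (σ (σ h))))
    multiple : m ∣ k h * m + k (σ h) * m + k (σ (σ h)) * m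
    multiple = ∣m∣n⇒∣m+n (∣m∣n⇒∣m+n (n∣m*n (k h)) (n∣m*n (k (σ h)))) (n∣m*n (k (σ (σ h))))

  w-admissible : ∀ h → Admissible (𝟙 (sp h)) (w h)
  w-admissible h = weight-admissible (out h) (toℕ<n (τ h))

  allSpecialWithSum-by-weights : ∀ k h → allSpecialWithSum k h ≡ (sp h ∧ sp (σ h) ∧ sp (σ (σ h)) ∧ (cycleSum w h ≡ᵇ k))
  allSpecialWithSum-by-weights k h = guarded-sum-test-cong (sp h) (sp (σ h)) (sp (σ (σ h))) k
    (sym ∘ weight-nonzero (out h)) (sym ∘ weight-nonzero (out (σ h))) (sym ∘ weight-nonzero (out (σ (σ h))))

  vertex-balance : ∀ h → cycleSum w h + cycleSum w h + 𝟙 (allSpecialWithSum m h) * m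
                          ≡ cycleSum (𝟙 ∘ sp) h * m + 𝟙 (allSpecialWithSum (2 * m) h) * m
  vertex-balance h rewrite allSpecialWithSum-by-weights m h | allSpecialWithSum-by-weights (2 * m) h =
    triple-balance (sp h) (sp (σ h)) (sp (σ (σ h)))
      (admissible-+ (admissible-+ (w-admissible h) (w-admissible (σ h))) (w-admissible (σ (σ h))))
      (vertex-divisible h)

  count-by-cycles : ∀ k → length (filterᵇ (vertexWith 𝔰 m τ k) (allFin H)) ≡ sumᶜ (𝟙 ∘ allSpecialWithSum k)
  count-by-cycles k = trans (length-filterᵇ-allFin (vertexWith 𝔰 m τ k))
                            (sum-cong-≗ (λ h → 𝟙-∧ (isLeast h) (allSpecialWithSum k h)))

  v₃-balance : sum w + sum w + v₃⁽¹⁾ 𝔰 m τ * m ≡ sum w + sum w + v₃⁽²⁾ 𝔰 m τ * m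
  v₃-balance = begin
    sum w + sum w + v₃⁽¹⁾ 𝔰 m τ * m
      ≡⟨ cong₂ (λ x v → x + x + v * m) (sum-by-cycles w) (count-by-cycles m) ⟩
    sumᶜ W + sumᶜ W + sumᶜ A₁ * m
      ≡⟨ trans (sumᶜ-+ (λ h → W h + W h) (λ h → A₁ h * m)) (cong₂ _+_ (sumᶜ-+ W W) (sumᶜ-*ʳ A₁ m)) ⟨
    sumᶜ (λ h → W h + W h + A₁ h * m)
      ≡⟨ sum-cong-≗ (λ h → cong (𝟙 (isLeast h) *_) (vertex-balance h)) ⟩
    sumᶜ (λ h → C h * m + A₂ h * m)
      ≡⟨ trans (sumᶜ-+ (λ h → C h * m) (λ h → A₂ h * m)) (cong₂ _+_ (sumᶜ-*ʳ C m) (sumᶜ-*ʳ A₂ m)) ⟩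
    sumᶜ C * m + sumᶜ A₂ * m
      ≡⟨ cong₂ (λ x v → x * m + v * m) (sum-by-cycles (𝟙 ∘ sp)) (count-by-cycles (2 * m)) ⟨
    sum (𝟙 ∘ sp) * m + v₃⁽²⁾ 𝔰 m τ * m
      ≡⟨ cong (_+ v₃⁽²⁾ 𝔰 m τ * m) edge-balance ⟨
    sum w + sum w + v₃⁽²⁾ 𝔰 m τ * m ∎
    where
    open ≡-Reasoning
    W = cycleSum w
    C = cycleSum (𝟙 ∘ sp)
    A₁ = 𝟙 ∘ allSpecialWithSum m
    A₂ = 𝟙 ∘ allSpecialWithSum (2 * m)

lemma18 : (m : ℕ) → 2 ≤ m → (𝔰 : OrientedCubicUnicellularMap)
          → (τ : Fin (OrientedCubicUnicellularMap.H 𝔰) → Fin m)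
          → IsTyping 𝔰 m τ
          → v₃⁽¹⁾ 𝔰 m τ ≡ v₃⁽²⁾ 𝔰 m τ
lemma18 m 2≤m 𝔰 τ typing = *-cancelʳ-≡ _ _ m {{m≢0}} (+-cancelˡ-≡ _ _ _ v₃-balance)
  where
  m≢0 : NonZero m
  m≢0 = ℕ.>-nonZero (<-≤-trans (s≤s z≤n) 2≤m)
  open CubicMapTyping m {{m≢0}} 𝔰 τ typing using (v₃-balance)
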